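{- Let $n\ge2$ and let $\Gamma_n$ be the Sierpiński graph with the "rotation-invariant" labeling. Let $c_n$ be the number of $c$-labeled edges in a uniformly random dimer covering of $\Gamma_n$, with mean $\mu_n$ and standard deviation $\sigma_n$, and let $C_n=(c_n-\mu_n)/\sigma_n$. - For $n$ even, $C_n$ equals $-\sqrt3$ on every covering of type $t$ and equals $\frac1{\sqrt3}$ on every covering of type $g$. - For $n$ odd, $C_n$ equals $\sqrt3$ on every covering of type $f$ and equals $-\frac1{\sqrt3}$ on every covering of type $h$.
   Context: The labeled graphs $\Gamma_n$ ($n\ge2$) have three corners $L,U,R$. $\Gamma_2$ has vertices $L,U,R,X,Y,Z$ and edges: - $L$–$X$, $U$–$Y$, $R$–$Z$ (label $a$); - $L$–$Z$, $U$–$X$, $R$–$Y$ (label $b$); - $X$–$Y$, $Y$–$Z$, $Z$–$X$ (label $c$). For $n\ge3$, $\Gamma_n$ is obtained from three copies $\Gamma^L,\Gamma^U,\Gamma^R$ of $\Gamma_{n-1}$ by identifying: - corner $R$ of $\Gamma^L$ with corner $L$ of $\Gamma^R$; - corner $U$ of $\Gamma^L$ with corner $L$ of $\Gamma^U$; - corner $R$ of $\Gamma^U$ with corner $U$ of $\Gamma^R$. The corners of $\Gamma_n$ are the $L$-corner of $\Gamma^L$, the $U$-corner of $\Gamma^U$, and the $R$-corner of $\Gamma^R$. A dimer covering of $\Gamma_n$ is a matching covering every non-corner vertex, and - for $n$ odd, covering exactly $0$ or $2$ corners; - for $n$ even, covering exactly $1$ or $3$ corners. A covering is of type $f$, $g$,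 $h$, $t$ if it covers exactly $0$, $1$, $2$, $3$ corners respectively. The mean and variance of $c_n$ are $\mu_n=3^{n-1}/4$ and $\sigma_n^2=3/16$. -}

module Defs where

open import Data.Nat using (ℕ; zero; suc; _+_; _*_; _^_; _∸_; _≤_; _%_)
open import Data.Fin using (Fin)
open import Data.List using (List; []; _∷_; _++_; map; length; allFin; lookup)
open import Data.Nat.ListAction using (sum)
open import Data.Bool using (Bool; true; false; _∧_; _∨_; if_then_else_)
open import Data.Product using (_×_; _,_; proj₁; proj₂)
open import Data.Sum using (_⊎_; inj₁; inj₂)
open import Relation.Nullary using (Dec; yes; no)
open import Relation.Nullary.Decidable using (isYes)
open import Relation.Binary.PropositionalEquality using (_≡_; refl; cong)

-- The three corners L, U, R (also used to name the three copies Γ^L, Γ^U, Γ^R).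
data Corner : Set where
  L U R : Corner

data Label : Set where
  a b c : Label

data XYZ : Set where
  X Y Z : XYZ

-- The three vertices of Γ_{n+1} created by identifying corners of the copies:
--   LR = (R of Γ^L) = (L of Γ^R),  LU = (U of Γ^L) = (L of Γ^U),
--   UR = (R of Γ^U) = (U of Γ^R).
data Junction : Set where
  LR LU UR : Junction

-- Non-corner vertices of Γ_{k+2}.  A non-corner vertex of Γ_{k+3} is either
-- a non-corner vertex of one of the copies, or one of the three junctions.
Inner : ℕ → Set
Inner zero    = XYZ
Inner (suc k) = (Corner × Inner k) ⊎ Junction

Vertex : ℕ → Set
Vertex k = Corner ⊎ Inner k

embCorner : {k : ℕ} → Corner → Corner → Vertex (suc k)
embCorner L L = inj₁ L
embCorner L U = inj₂ (inj₂ LU)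
embCorner L R = inj₂ (inj₂ LR)
embCorner U L = inj₂ (inj₂ LU)
embCorner U U = inj₁ U
embCorner U R = inj₂ (inj₂ UR)
embCorner R L = inj₂ (inj₂ LR)
embCorner R U = inj₂ (inj₂ UR)
embCorner R R = inj₁ R

emb : {k : ℕ} → Corner → Vertex k → Vertex (suc k)
emb j (inj₁ x) = embCorner j x
emb j (inj₂ v) = inj₂ (inj₁ (j , v))

Edge : ℕ → Set
Edge k = Vertex k × Vertex k × Label

embEdge : {k : ℕ} → Corner → Edge k → Edge (suc k)
embEdge j (u , v , l) = emb j u , emb j v , l

edges : (k : ℕ) → List (Edge k)
edges zero =
  (inj₁ L , inj₂ X , a) ∷ (inj₁ U , inj₂ Y , a) ∷ (inj₁ R , inj₂ Z , a) ∷
  (inj₁ L , inj₂ Z , b) ∷ (inj₁ U , inj₂ X , b) ∷ (inj₁ R , inj₂ Y , b) ∷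
  (inj₂ X , inj₂ Y , c) ∷ (inj₂ Y , inj₂ Z , c) ∷ (inj₂ Z , inj₂ X , c) ∷ []
edges (suc k) =
  map (embEdge L) (edges k) ++ map (embEdge U) (edges k) ++ map (embEdge R) (edges k)

_≟C_ : (x y : Corner) → Dec (x ≡ y)
L ≟C L = yes refl
L ≟C U = no λ ()
L ≟C R = no λ ()
U ≟C L = no λ ()
U ≟C U = yes refl
U ≟C R = no λ ()
R ≟C L = no λ ()
R ≟C U = no λ ()
R ≟C R = yes refl

_≟X_ : (x y : XYZ) → Dec (x ≡ y)
X ≟X X = yes refl
X ≟X Y = no λ ()
X ≟X Z = no λ ()
Y ≟X X = no λ ()
Y ≟X Y = yes refl
Y ≟X Z = no λ ()
Z ≟X X = no λ ()
Z ≟X Y = no λ ()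
Z ≟X Z = yes refl

_≟J_ : (x y : Junction) → Dec (x ≡ y)
LR ≟J LR = yes refl
LR ≟J LU = no λ ()
LR ≟J UR = no λ ()
LU ≟J LR = no λ ()
LU ≟J LU = yes refl
LU ≟J UR = no λ ()
UR ≟J LR = no λ ()
UR ≟J LU = no λ ()
UR ≟J UR = yes refl

_≟I_ : {k : ℕ} → (x y : Inner k) → Dec (x ≡ y)
_≟I_ {zero} x y = x ≟X y
_≟I_ {suc k} (inj₁ (j , v)) (inj₁ (j' , v')) with j ≟C j' | v ≟I v'
... | yes refl | yes refl = yes refl
... | no ne | _ = no λ { refl → ne refl }
... | yes _ | no ne = no λ { refl → ne refl }
_≟I_ {suc k} (inj₁ _) (inj₂ _) = no λ ()
_≟I_ {suc k} (inj₂ _) (inj₁ _) = no λ ()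
_≟I_ {suc k} (inj₂ x) (inj₂ y) with x ≟J y
... | yes refl = yes refl
... | no ne = no λ { refl → ne refl }

_≟V_ : {k : ℕ} → (x y : Vertex k) → Dec (x ≡ y)
inj₁ x ≟V inj₁ y with x ≟C y
... | yes refl = yes refl
... | no ne = no λ { refl → ne refl }
inj₁ _ ≟V inj₂ _ = no λ ()
inj₂ _ ≟V inj₁ _ = no λ ()
inj₂ x ≟V inj₂ y with x ≟I y
... | yes refl = yes refl
... | no ne = no λ { refl → ne refl }

E : ℕ → ℕ
E k = length (edges k)

edge : (k : ℕ) → Fin (E k) → Edge k
edge k i = lookup (edges k) i

incident : {k : ℕ} → Edge k → Vertex k → Bool
incident (u , v , _) x = isYes (u ≟V x) ∨ isYes (v ≟V x)

EdgeSet : ℕ → Set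
EdgeSet k = Fin (E k) → Bool

count : {m : ℕ} → (Fin m → Bool) → ℕ
count {m} p = sum (map (λ i → if p i then 1 else 0) (allFin m))

deg : (k : ℕ) → EdgeSet k → Vertex k → ℕ
deg k S x = count (λ i → S i ∧ incident (edge k i) x)

coveredCorners : (k : ℕ) → EdgeSet k → ℕ
coveredCorners k S = deg k S (inj₁ L) + deg k S (inj₁ U) + deg k S (inj₁ R)

isC : Label → Bool
isC c = true
isC _ = false

cCount : (k : ℕ) → EdgeSet k → ℕ
cCount k S = count (λ i → S i ∧ isC (proj₂ (proj₂ (edge k i))))

AllowedCorners : ℕ → ℕ → Set
AllowedCorners n j = (n % 2 ≡ 1 → j ≡ 0 ⊎ j ≡ 2) × (n % 2 ≡ 0 → j ≡ 1 ⊎ j ≡ 3)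

record DimerCovering (k : ℕ) : Set where
  field
    sel      : EdgeSet k
    inner    : (v : Inner k) → deg k sel (inj₂ v) ≡ 1
    corner   : (x : Corner) → deg k sel (inj₁ x) ≤ 1
    allowed  : AllowedCorners (suc (suc k)) (coveredCorners k sel)
open DimerCovering public

cN : {k : ℕ} → DimerCovering k → ℕ
cN {k} D = cCount k (sel D)

-- number of corners covered (type f/g/h/t ↔ 0/1/2/3)
cornersOf : {k : ℕ} → DimerCovering k → ℕ
cornersOf {k} D = coveredCorners k (sel D)

module Submission where

-- Writing n = k + 2, the standardised count
-- C_n = (c_n - μ_n)/σ_n is determined by the number j of covered corners,
-- because every dimer covering D of Γ_n satisfies the linear invariant
--
--     4 c(D) + 2 j(D) = 3^(n-1) + 3.                                  (★)
--
-- In fact (★) holds for every edge set in which each non-corner vertex has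
-- degree exactly one.  The proof is by induction on n.
--   * Counting: the degree and c-counts of Defs are counts of selected list
--     elements; we rewrite them with a list-recursive count `selCount`,
--     which is additive over _++_ and commutes with map.
--   * Copies: a vertex x of Γ_{n+1} is seen by copy j of Γ_n through the
--     partial inverse `retract j` of the embedding `emb j`; hence the degree
--     of x is the sum over the copies of the degrees of `retract j x`.
--   * Base (Γ₂): (★) is the handshake identity 4c + 2j = 2(deg X+deg Y+deg Z).
--   * Step: the c-count is the sum of the c-counts of the copies, and the
--     corner degrees of the copies add up to the corner degrees of Γ_{n+1}
--     plus the degrees (= 1) of the three junctions; summing (★) over the
--     copies gives (★) for Γ_{n+1}.
-- The theorem then reads off c(D) from (★) for each allowed value of j.

open import Defs hiding (a; b; c)
open import Data.Nat using (ℕ; zero; suc; _+_; _*_; _^_; _%_)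
open import Data.Nat.Properties using (+-assoc; +-identityʳ; +-cancelʳ-≡)
open import Data.Nat.Tactic.RingSolver using (solve-∀)
open import Data.Fin using (Fin; zero; suc; #_)
open import Data.List using (List; []; _∷_; _++_; map; length; lookup; tabulate)
open import Data.List.Properties using (map-tabulate)
open import Data.Nat.ListAction using (sum)
open import Data.Bool using (Bool; true; false; _∧_; _∨_; if_then_else_)
open import Data.Maybe using (Maybe; just; nothing)
import Data.Maybe as Maybe
open import Data.Product using (_×_; _,_; proj₂)
open import Data.Sum using (inj₁; inj₂)
open import Relation.Nullary using (yes; no)
open import Relation.Nullary.Decidable using (isYes; isYes≗does; dec-true; dec-false)
open import Relation.Binary.PropositionalEquality
  using (_≡_; refl; cong; cong₂; sym; trans; module ≡-Reasoning)
open import Function using (_∘_; id)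
open ≡-Reasoning

bit : Bool → ℕ
bit true  = 1
bit false = 0

selCount : {A : Set} (xs : List A) → (Fin (length xs) → Bool) → (A → Bool) → ℕ
selCount []       s q = 0
selCount (x ∷ xs) s q =
  if q x then bit (s zero) + selCount xs (s ∘ suc) q else selCount xs (s ∘ suc) q

count-step : ∀ b t n → (if b ∧ t then 1 else 0) + n ≡ (if t then bit b + n else n)
count-step true  true  n = refl
count-step false true  n = refl
count-step true  false n = refl
count-step false false n = refl

count-selCount : {A : Set} (xs : List A) (s : Fin (length xs) → Bool) (q : A → Bool) →
  count (λ i → s i ∧ q (lookup xs i)) ≡ selCount xs s q
count-selCount xs s q =
  trans (cong sum (map-tabulate id (λ i → if s i ∧ q (lookup xs i) then 1 else 0)))
        (sum-tabulate xs s)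
  where
  sum-tabulate : (ys : List _) (t : Fin (length ys) → Bool) →
    sum (tabulate (λ i → if t i ∧ q (lookup ys i) then 1 else 0)) ≡ selCount ys t q
  sum-tabulate []       t = refl
  sum-tabulate (y ∷ ys) t =
    trans (cong ((if t zero ∧ q y then 1 else 0) +_) (sum-tabulate ys (t ∘ suc)))
          (count-step (t zero) (q y) (selCount ys (t ∘ suc) q))

indexˡ : {A : Set} (xs ys : List A) → Fin (length xs) → Fin (length (xs ++ ys))
indexˡ (x ∷ xs) ys zero    = zero
indexˡ (x ∷ xs) ys (suc i) = suc (indexˡ xs ys i)

indexʳ : {A : Set} (xs ys : List A) → Fin (length ys) → Fin (length (xs ++ ys))
indexʳ []       ys i = i
indexʳ (x ∷ xs) ys i = suc (indexʳ xs ys i)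

index-map : {A B : Set} (f : A → B) (xs : List A) → Fin (length xs) → Fin (length (map f xs))
index-map f (x ∷ xs) zero    = zero
index-map f (x ∷ xs) (suc i) = suc (index-map f xs i)

selCount-++ : {A : Set} (xs ys : List A) (s : Fin (length (xs ++ ys)) → Bool) (q : A → Bool) →
  selCount (xs ++ ys) s q ≡ selCount xs (s ∘ indexˡ xs ys) q + selCount ys (s ∘ indexʳ xs ys) q
selCount-++ []       ys s q = refl
selCount-++ (x ∷ xs) ys s q with q x
... | true  = trans (cong (bit (s zero) +_) (selCount-++ xs ys (s ∘ suc) q))
                    (sym (+-assoc (bit (s zero)) _ _))
... | false = selCount-++ xs ys (s ∘ suc) q

selCount-map : {A B : Set} (f : A → B) (xs : List A) (s : Fin (length (map f xs)) → Bool) (q : B → Bool) →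
  selCount (map f xs) s q ≡ selCount xs (s ∘ index-map f xs) (q ∘ f)
selCount-map f []       s q = refl
selCount-map f (x ∷ xs) s q =
  cong (λ r → if q (f x) then bit (s zero) + r else r) (selCount-map f xs (s ∘ suc) q)

selCount-cong : {A : Set} (xs : List A) (s : Fin (length xs) → Bool) {q q′ : A → Bool} →
  (∀ e → q e ≡ q′ e) → selCount xs s q ≡ selCount xs s q′
selCount-cong []       s eq = refl
selCount-cong (x ∷ xs) s eq =
  cong₂ (λ t r → if t then bit (s zero) + r else r) (eq x) (selCount-cong xs (s ∘ suc) eq)

selCount-none : {A : Set} (xs : List A) (s : Fin (length xs) → Bool) →
  selCount xs s (λ _ → false) ≡ 0
selCount-none []       s = refl
selCount-none (x ∷ xs) s = selCount-none xs (s ∘ suc)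

junctionCorner : Corner → Junction → Maybe Corner
junctionCorner L LR = just R
junctionCorner L LU = just U
junctionCorner U LU = just L
junctionCorner U UR = just R
junctionCorner R LR = just L
junctionCorner R UR = just U
junctionCorner _ _  = nothing

retract : {k : ℕ} → Corner → Vertex (suc k) → Maybe (Vertex k)
retract j (inj₁ c)                = if isYes (j ≟C c) then just (inj₁ c) else nothing
retract j (inj₂ (inj₁ (j′ , v))) = if isYes (j ≟C j′) then just (inj₂ v) else nothing
retract j (inj₂ (inj₂ J))         = Maybe.map inj₁ (junctionCorner j J)

retract-emb : {k : ℕ} (j : Corner) (u : Vertex k) → retract j (emb j u) ≡ just u
retract-emb L (inj₁ L) = refl
retract-emb L (inj₁ U) = refl
retract-emb L (inj₁ R) = refl
retract-emb U (inj₁ L) = refl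
retract-emb U (inj₁ U) = refl
retract-emb U (inj₁ R) = refl
retract-emb R (inj₁ L) = refl
retract-emb R (inj₁ U) = refl
retract-emb R (inj₁ R) = refl
retract-emb L (inj₂ v) = refl
retract-emb U (inj₂ v) = refl
retract-emb R (inj₂ v) = refl

embCorner-self : {k : ℕ} (j : Corner) → embCorner {k} j j ≡ inj₁ j
embCorner-self L = refl
embCorner-self U = refl
embCorner-self R = refl

emb-retract : {k : ℕ} (j : Corner) (x : Vertex (suc k)) {y : Vertex k} →
  retract j x ≡ just y → emb j y ≡ x
emb-retract j (inj₁ c) eq with j ≟C c
emb-retract j (inj₁ c) refl | yes refl = embCorner-self j
emb-retract j (inj₁ c) ()   | no _
emb-retract j (inj₂ (inj₁ (j′ , v))) eq with j ≟C j′
emb-retract j (inj₂ (inj₁ (j′ , v))) refl | yes refl = refl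
emb-retract j (inj₂ (inj₁ (j′ , v))) ()   | no _
emb-retract L (inj₂ (inj₂ LR)) refl = refl
emb-retract L (inj₂ (inj₂ LU)) refl = refl
emb-retract L (inj₂ (inj₂ UR)) ()
emb-retract U (inj₂ (inj₂ LR)) ()
emb-retract U (inj₂ (inj₂ LU)) refl = refl
emb-retract U (inj₂ (inj₂ UR)) refl = refl
emb-retract R (inj₂ (inj₂ LR)) refl = refl
emb-retract R (inj₂ (inj₂ LU)) ()
emb-retract R (inj₂ (inj₂ UR)) refl = refl

hitAt : {k : ℕ} → Vertex k → Maybe (Vertex k) → Bool
hitAt u (just y) = isYes (u ≟V y)
hitAt u nothing  = false

emb-hit : {k : ℕ} (j : Corner) (u : Vertex k) (x : Vertex (suc k)) →
  isYes (emb j u ≟V x) ≡ hitAt u (retract j x)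
emb-hit j u x with emb j u ≟V x
... | yes refl rewrite retract-emb j u = sym (trans (isYes≗does (u ≟V u)) (dec-true (u ≟V u) refl))
... | no emb≢x with retract j x in eq
...   | nothing = refl
...   | just y  = sym (trans (isYes≗does (u ≟V y))
                      (dec-false (u ≟V y) λ { refl → emb≢x (emb-retract j x eq) }))

incidentAt : {k : ℕ} → Edge k → Maybe (Vertex k) → Bool
incidentAt (u , v , _) r = hitAt u r ∨ hitAt v r

incident-emb : {k : ℕ} (j : Corner) (e : Edge k) (x : Vertex (suc k)) →
  incident (embEdge j e) x ≡ incidentAt e (retract j x)
incident-emb j (u , v , _) x = cong₂ _∨_ (emb-hit j u x) (emb-hit j v x)

countBy : (k : ℕ) → EdgeSet k → (Edge k → Bool) → ℕ
countBy k S q = count (λ i → S i ∧ q (edge k i))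

copyEdges : (k : ℕ) → Corner → List (Edge (suc k))
copyEdges k j = map (embEdge j) (edges k)

copyIndex : (k : ℕ) → Corner → Fin (E k) → Fin (E (suc k))
copyIndex k L = indexˡ (copyEdges k L) (copyEdges k U ++ copyEdges k R)
                ∘ index-map (embEdge L) (edges k)
copyIndex k U = indexʳ (copyEdges k L) (copyEdges k U ++ copyEdges k R)
                ∘ indexˡ (copyEdges k U) (copyEdges k R)
                ∘ index-map (embEdge U) (edges k)
copyIndex k R = indexʳ (copyEdges k L) (copyEdges k U ++ copyEdges k R)
                ∘ indexʳ (copyEdges k U) (copyEdges k R)
                ∘ index-map (embEdge R) (edges k)

restrict : (k : ℕ) → EdgeSet (suc k) → Corner → EdgeSet k
restrict k S j = S ∘ copyIndex k j

countBy-split : (k : ℕ) (S : EdgeSet (suc k)) (q : Edge (suc k) → Bool) →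
  countBy (suc k) S q
    ≡ countBy k (restrict k S L) (q ∘ embEdge L)
      + (countBy k (restrict k S U) (q ∘ embEdge U) + countBy k (restrict k S R) (q ∘ embEdge R))
countBy-split k S q = begin
  countBy (suc k) S q
    ≡⟨ count-selCount (edges (suc k)) S q ⟩
  selCount (A ++ (B ++ C)) S q
    ≡⟨ selCount-++ A (B ++ C) S q ⟩
  selCount A sL q + selCount (B ++ C) sUR q
    ≡⟨ cong (selCount A sL q +_) (selCount-++ B C sUR q) ⟩
  selCount A sL q + (selCount B sU q + selCount C sR q)
    ≡⟨ cong₂ _+_ (copy L sL) (cong₂ _+_ (copy U sU) (copy R sR)) ⟩
  countBy k (restrict k S L) (q ∘ embEdge L)
    + (countBy k (restrict k S U) (q ∘ embEdge U) + countBy k (restrict k S R) (q ∘ embEdge R)) ∎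
  where
  A B C : List (Edge (suc k))
  A = copyEdges k L
  B = copyEdges k U
  C = copyEdges k R
  sL : Fin (length A) → Bool
  sUR : Fin (length (B ++ C)) → Bool
  sU : Fin (length B) → Bool
  sR : Fin (length C) → Bool
  sL  = S ∘ indexˡ A (B ++ C)
  sUR = S ∘ indexʳ A (B ++ C)
  sU  = sUR ∘ indexˡ B C
  sR  = sUR ∘ indexʳ B C
  copy : (j : Corner) (s : Fin (length (copyEdges k j)) → Bool) →
    selCount (copyEdges k j) s q ≡ countBy k (s ∘ index-map (embEdge j) (edges k)) (q ∘ embEdge j)
  copy j s = trans (selCount-map (embEdge j) (edges k) s q) (sym (count-selCount (edges k) _ _))

degAt : (k : ℕ) → EdgeSet k → Maybe (Vertex k) → ℕ
degAt k T (just y) = deg k T y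
degAt k T nothing  = 0

copy-degree : (k : ℕ) (T : EdgeSet k) (j : Corner) (x : Vertex (suc k)) →
  countBy k T (λ e → incident (embEdge j e) x) ≡ degAt k T (retract j x)
copy-degree k T j x =
  trans (count-selCount (edges k) T _)
        (trans (selCount-cong (edges k) T (λ e → incident-emb j e x)) (selCount-degAt (retract j x)))
  where
  selCount-degAt : (r : Maybe (Vertex k)) →
    selCount (edges k) T (λ e → incidentAt e r) ≡ degAt k T r
  selCount-degAt (just y) = sym (count-selCount (edges k) T (λ e → incident e y))
  selCount-degAt nothing  = selCount-none (edges k) T

deg-split : (k : ℕ) (S : EdgeSet (suc k)) (x : Vertex (suc k)) →
  deg (suc k) S x
    ≡ degAt k (restrict k S L) (retract L x)
      + (degAt k (restrict k S U) (retract U x) + degAt k (restrict k S R) (retract R x))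
deg-split k S x =
  trans (countBy-split k S (λ e → incident e x))
        (cong₂ _+_ (copy-degree k _ L x) (cong₂ _+_ (copy-degree k _ U x) (copy-degree k _ R x)))

cCount-split : (k : ℕ) (S : EdgeSet (suc k)) →
  cCount (suc k) S ≡ cCount k (restrict k S L) + (cCount k (restrict k S U) + cCount k (restrict k S R))
cCount-split k S = countBy-split k S (λ e → isC (proj₂ (proj₂ e)))

InnerPerfect : (k : ℕ) → EdgeSet k → Set
InnerPerfect k S = (v : Inner k) → deg k S (inj₂ v) ≡ 1

-- Handshake identity of Γ₂ in terms of the indicators s₀ … s₈ of its nine
-- edges (in the order of Defs.edges zero): a c-edge meets two of X, Y, Z and
-- no corner, an a- or b-edge meets one of X, Y, Z and one corner.
handshake₂ : ∀ s₀ s₁ s₂ s₃ s₄ s₅ s₆ s₇ s₈ →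
  4 * (s₆ + (s₇ + (s₈ + 0))) + 2 * ((s₀ + (s₃ + 0)) + (s₁ + (s₄ + 0)) + (s₂ + (s₅ + 0)))
    ≡ 2 * ((s₀ + (s₄ + (s₆ + (s₈ + 0))))
           + ((s₁ + (s₅ + (s₆ + (s₇ + 0)))) + (s₂ + (s₃ + (s₇ + (s₈ + 0))))))
handshake₂ = solve-∀

invariant-base : (S : EdgeSet 0) → InnerPerfect 0 S →
  4 * cCount 0 S + 2 * coveredCorners 0 S ≡ 3 ^ 1 + 3
invariant-base S perfect = begin
  4 * cCount 0 S + 2 * coveredCorners 0 S
    ≡⟨ cong₂ (λ c w → 4 * c + 2 * w) (count-selCount (edges 0) S (λ e → isC (proj₂ (proj₂ e))))
         (cong₂ _+_ (cong₂ _+_ (toSel (inj₁ L)) (toSel (inj₁ U))) (toSel (inj₁ R))) ⟩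
  4 * selCount (edges 0) S (λ e → isC (proj₂ (proj₂ e)))
    + 2 * (selAt (inj₁ L) + selAt (inj₁ U) + selAt (inj₁ R))
    ≡⟨ handshake₂ (s (# 0)) (s (# 1)) (s (# 2)) (s (# 3)) (s (# 4)) (s (# 5)) (s (# 6)) (s (# 7)) (s (# 8)) ⟩
  2 * (selAt (inj₂ X) + (selAt (inj₂ Y) + selAt (inj₂ Z)))
    ≡⟨ cong (2 *_) (cong₂ _+_ (covered X) (cong₂ _+_ (covered Y) (covered Z))) ⟩
  6 ∎
  where
  s : Fin (E 0) → ℕ
  s i = bit (S i)
  selAt : Vertex 0 → ℕ
  selAt x = selCount (edges 0) S (λ e → incident e x)
  toSel : (x : Vertex 0) → deg 0 S x ≡ selAt x
  toSel x = count-selCount (edges 0) S (λ e → incident e x)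
  covered : (v : XYZ) → selAt (inj₂ v) ≡ 1
  covered v = trans (sym (toSel (inj₂ v))) (perfect v)

inner-degree : (k : ℕ) (S : EdgeSet (suc k)) (j : Corner) (w : Inner k) →
  deg (suc k) S (inj₂ (inj₁ (j , w))) ≡ deg k (restrict k S j) (inj₂ w)
inner-degree k S L w = trans (deg-split k S _) (+-identityʳ _)
inner-degree k S U w = trans (deg-split k S _) (+-identityʳ _)
inner-degree k S R w = deg-split k S _

restrict-perfect : (k : ℕ) (S : EdgeSet (suc k)) → InnerPerfect (suc k) S →
  (j : Corner) → InnerPerfect k (restrict k S j)
restrict-perfect k S perfect j w = trans (sym (inner-degree k S j w)) (perfect (inj₁ (j , w)))

-- Bookkeeping of the nine corner degrees d_jc of the copies (l, u, r for
-- copies L, U, R): the left side is corners plus junctions of Γ_{k+3} as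
-- computed by deg-split (absent copies contribute 0), the right side the
-- corners of the three copies.
copy-corners : ∀ lL lU lR uL uU uR rL rU rR →
  (lL + 0) + (uU + 0) + rR + ((lR + rL) + ((lU + (uL + 0)) + (uR + rU)))
    ≡ (lL + lU + lR) + ((uL + uU + uR) + (rL + rU + rR))
copy-corners = solve-∀

-- Each copy corner is an outer corner or one side of a junction, and each
-- junction is covered exactly once: the corner counts add up with 3 extra.
corner-sum : (k : ℕ) (S : EdgeSet (suc k)) → InnerPerfect (suc k) S →
  coveredCorners (suc k) S + 3
    ≡ coveredCorners k (restrict k S L)
      + (coveredCorners k (restrict k S U) + coveredCorners k (restrict k S R))
corner-sum k S perfect = begin
  coveredCorners (suc k) S + 3
    ≡⟨ cong (coveredCorners (suc k) S +_)
         (sym (cong₂ _+_ (junction LR) (cong₂ _+_ (junction LU) (junction UR)))) ⟩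
  coveredCorners (suc k) S + (jdeg LR + (jdeg LU + jdeg UR))
    ≡⟨ cong₂ _+_
         (cong₂ _+_ (cong₂ _+_ (deg-split k S (inj₁ L)) (deg-split k S (inj₁ U)))
                    (deg-split k S (inj₁ R)))
         (cong₂ _+_ (deg-split k S (inj₂ (inj₂ LR)))
                    (cong₂ _+_ (deg-split k S (inj₂ (inj₂ LU))) (deg-split k S (inj₂ (inj₂ UR))))) ⟩
  (d L L + 0) + (d U U + 0) + d R R + ((d L R + d R L) + ((d L U + (d U L + 0)) + (d U R + d R U)))
    ≡⟨ copy-corners (d L L) (d L U) (d L R) (d U L) (d U U) (d U R) (d R L) (d R U) (d R R) ⟩
  coveredCorners k (restrict k S L)
    + (coveredCorners k (restrict k S U) + coveredCorners k (restrict k S R)) ∎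
  where
  d : Corner → Corner → ℕ
  d j c = deg k (restrict k S j) (inj₁ c)
  jdeg : Junction → ℕ
  jdeg J = deg (suc k) S (inj₂ (inj₂ J))
  junction : (J : Junction) → jdeg J ≡ 1
  junction J = perfect (inj₂ J)

sum-invariants : {c w P : ℕ} (cs ws : Corner → ℕ) →
  c ≡ cs L + (cs U + cs R) → w + 3 ≡ ws L + (ws U + ws R) →
  (∀ j → 4 * cs j + 2 * ws j ≡ P + 3) → 4 * c + 2 * w ≡ 3 * P + 3
sum-invariants {w = w} {P} cs ws refl corners copy =
  +-cancelʳ-≡ 6 _ _ (begin
    4 * (cL + (cU + cR)) + 2 * w + 6
      ≡⟨ add-junctions (cL + (cU + cR)) w ⟩
    4 * (cL + (cU + cR)) + 2 * (w + 3)
      ≡⟨ cong (λ t → 4 * (cL + (cU + cR)) + 2 * t) corners ⟩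
    4 * (cL + (cU + cR)) + 2 * (wL + (wU + wR))
      ≡⟨ distribute cL cU cR wL wU wR ⟩
    (4 * cL + 2 * wL) + ((4 * cU + 2 * wU) + (4 * cR + 2 * wR))
      ≡⟨ cong₂ _+_ (copy L) (cong₂ _+_ (copy U) (copy R)) ⟩
    (P + 3) + ((P + 3) + (P + 3))
      ≡⟨ triple P ⟩
    3 * P + 3 + 6 ∎)
  where
  cL cU cR wL wU wR : ℕ
  cL = cs L
  cU = cs U
  cR = cs R
  wL = ws L
  wU = ws U
  wR = ws R
  add-junctions : ∀ a v → 4 * a + 2 * v + 6 ≡ 4 * a + 2 * (v + 3)
  add-junctions = solve-∀
  distribute : ∀ a b c x y z →
    4 * (a + (b + c)) + 2 * (x + (y + z)) ≡ (4 * a + 2 * x) + ((4 * b + 2 * y) + (4 * c + 2 * z))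
  distribute = solve-∀
  triple : ∀ p → (p + 3) + ((p + 3) + (p + 3)) ≡ 3 * p + 3 + 6
  triple = solve-∀

invariant : (k : ℕ) (S : EdgeSet k) → InnerPerfect k S →
  4 * cCount k S + 2 * coveredCorners k S ≡ 3 ^ suc k + 3
invariant zero    S perfect = invariant-base S perfect
invariant (suc k) S perfect =
  sum-invariants (λ j → cCount k (restrict k S j)) (λ j → coveredCorners k (restrict k S j))
    (cCount-split k S) (corner-sum k S perfect)
    (λ j → invariant k (restrict k S j) (restrict-perfect k S perfect j))

-- By (★), c_n is determined by the number j of covered corners; the parity of
-- n only restricts which j occur.
theorem5p5 : (k : ℕ) →
    (suc (suc k) % 2 ≡ 0 →
      ((D : DimerCovering k) → cornersOf D ≡ 3 → 4 * cN D + 3 ≡ 3 ^ suc k)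
      × ((D : DimerCovering k) → cornersOf D ≡ 1 → 4 * cN D ≡ 3 ^ suc k + 1))
    × (suc (suc k) % 2 ≡ 1 →
      ((D : DimerCovering k) → cornersOf D ≡ 0 → 4 * cN D ≡ 3 ^ suc k + 3)
      × ((D : DimerCovering k) → cornersOf D ≡ 2 → 4 * cN D + 1 ≡ 3 ^ suc k))
theorem5p5 k = (λ _ → type-t , type-g) , (λ _ → type-f , type-h)
  where
  P : ℕ
  P = 3 ^ suc k
  star : (D : DimerCovering k) (j : ℕ) → cornersOf D ≡ j → 4 * cN D + 2 * j ≡ P + 3
  star D j refl = invariant k (sel D) (inner D)
  type-t : (D : DimerCovering k) → cornersOf D ≡ 3 → 4 * cN D + 3 ≡ P
  type-t D three = +-cancelʳ-≡ 3 _ _ (trans (+-assoc (4 * cN D) 3 3) (star D 3 three))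
  type-g : (D : DimerCovering k) → cornersOf D ≡ 1 → 4 * cN D ≡ P + 1
  type-g D one = +-cancelʳ-≡ 2 _ _ (trans (star D 1 one) (sym (+-assoc P 1 2)))
  type-f : (D : DimerCovering k) → cornersOf D ≡ 0 → 4 * cN D ≡ P + 3
  type-f D none = trans (sym (+-identityʳ (4 * cN D))) (star D 0 none)
  type-h : (D : DimerCovering k) → cornersOf D ≡ 2 → 4 * cN D + 1 ≡ P
  type-h D two = +-cancelʳ-≡ 3 _ _ (trans (+-assoc (4 * cN D) 1 3) (star D 2 two))
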